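{- The logics $\mathsf{CTL}_\delta$ and $\mathsf{CTL}_\infty$ are equally expressive. More precisely: there is a translation $\mathsf{D}$ from $\mathsf{CTL}_\infty$ formulas to $\mathsf{CTL}_\delta$ formulas and a translation $\mathsf{E}$ from $\mathsf{CTL}_\delta$ formulas to $\mathsf{CTL}_\infty$ formulas such that, for every Kripke structure $K$ and every state $s$ of $K$, for every $\mathsf{CTL}_\infty$ formula $\phi$ we have $s\models\phi$ in $K$ iff $s\models\mathsf{D}(\phi)$ in $D(K)$, and for every $\mathsf{CTL}_\delta$ formula $\phi$ we have $s\models\phi$ in $D(K)$ iff $s\models\mathsf{E}(\phi)$ in $K$.
   Context: A Kripke structure $(S,L,\rightarrow)$ has a set of states $S$, a labelling $L:S\to 2^{\mathbf{AP}}$ into sets of atomic propositions, and a transition relation ${\rightarrow}\subseteq S\times S$; it need not be total. A maximal path is an infinite path or a finite path whose last state has no outgoing transition (a deadlock state). Formulas are evaluated using maximal paths: $s\models\exists\psi$ iff some maximal path from $s$ satisfies $\psi$; $\pi\models\psi\,\mathsf{U}\,\psi'$ iff some suffix $\pi'$ of $\pi$ satisfies $\psi'$ and all suffixes of $\pi$ strictly longer than $\pi'$ satisfy $\psi$; $\top$ is the empty conjunction, $\mathsf{F}\psi=\top\,\mathsf{U}\,\psi$, $\mathsf{G}\psi=\neg\mathsf{F}\neg\psi$. Arbitrary (set-indexed) conjunctions are allowed. $\mathsf{CTL}_{ -\mathsf{X}}$ (CTL without next state) is given by state formulas $\phi ::= p \mid \neg\phi \mid \bigwedge\Phi' \mid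 \exists(\phi\,\mathsf{U}\,\phi) \mid \exists\mathsf{G}\phi$ with $p\in\mathbf{AP}$. $\mathsf{CTL}_\delta$ is $\mathsf{CTL}_{ -\mathsf{X}}$ extended with a fresh atomic proposition $\delta$. $\mathsf{CTL}_\infty$ is given by $\phi ::= p \mid \neg\phi \mid \bigwedge\Phi' \mid \exists(\phi\,\mathsf{U}\,\phi) \mid \exists^\infty\mathsf{G}\phi$, where $s\models\exists^\infty\mathsf{G}\phi$ iff there exists an infinite path from $s$ all of whose states satisfy $\phi$. The deadlock extension $D(K)$ of a Kripke structure $K$ is obtained by adding a fresh state $s_\delta$, labelled by the fresh atomic proposition $\delta$, together with a transition from $s_\delta$ to itself and from every deadlock state of $K$ to $s_\delta$. -}

module Defs where

open import Data.Nat using (ℕ; zero; suc; _≤_; _<_)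
open import Data.Unit using (⊤; tt)
open import Data.Empty using (⊥)
open import Data.Sum using (_⊎_; inj₁; inj₂)
open import Data.Maybe using (Maybe; just; nothing)
open import Data.Product using (Σ; _×_; _,_; ∃)
open import Relation.Nullary using (¬_)
open import Relation.Binary.PropositionalEquality using (_≡_)

-- Kripke structures (transition relation need not be total)

record Kripke (AP : Set) : Set₁ where
  field
    State : Set
    L     : State → AP → Set
    _⟶_   : State → State → Set

open Kripke public

Deadlock : ∀ {AP} (K : Kripke AP) → State K → Set
Deadlock K s = ∀ t → ¬ (_⟶_ K s t)

-- A path is a sequence of states indexed by ℕ together with a bound:
-- `inf` (infinite path) or `fin n` (states at indices 0..n; later
-- entries of the sequence are irrelevant).

data Bound : Set where
  inf : Bound
  fin : ℕ → Bound

InRange : ℕ → Bound → Set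
InRange k inf     = ⊤
InRange k (fin n) = k ≤ n

record MaxPath {AP} (K : Kripke AP) (s : State K) : Set where
  field
    seq     : ℕ → State K
    bound   : Bound
    start   : seq 0 ≡ s
    steps   : ∀ i → InRange (suc i) bound → _⟶_ K (seq i) (seq (suc i))
    maximal : ∀ n → bound ≡ fin n → Deadlock K (seq n)

open MaxPath public

-- π ⊨ P U Q  (P, Q state properties, evaluated on the first state of a
-- suffix): some suffix (starting at index k) satisfies Q and all strictly
-- longer suffixes (indices j < k) satisfy P.
PathU : ∀ {AP} {K : Kripke AP} {s} → MaxPath K s →
        (State K → Set) → (State K → Set) → Set
PathU π P Q = Σ ℕ λ k → InRange k (bound π) × Q (seq π k)
                        × (∀ j → j < k → P (seq π j))

PathF : ∀ {AP} {K : Kripke AP} {s} → MaxPath K s → (State K → Set) → Set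
PathF π Q = PathU π (λ _ → ⊤) Q

PathG : ∀ {AP} {K : Kripke AP} {s} → MaxPath K s → (State K → Set) → Set
PathG π P = ¬ PathF π (λ t → ¬ P t)

data CTL (AP : Set) : Set₁ where
  atom : AP → CTL AP
  neg  : CTL AP → CTL AP
  conj : (I : Set) → (I → CTL AP) → CTL AP
  EU   : CTL AP → CTL AP → CTL AP
  EG   : CTL AP → CTL AP

sat : ∀ {AP} (K : Kripke AP) → CTL AP → State K → Set
sat K (atom p)   s = L K s p
sat K (neg φ)    s = ¬ sat K φ s
sat K (conj I f) s = ∀ (i : I) → sat K (f i) s
sat K (EU φ ψ)   s = Σ (MaxPath K s) λ π → PathU π (sat K φ) (sat K ψ)
sat K (EG φ)     s = Σ (MaxPath K s) λ π → PathG π (sat K φ)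

CTLδ : Set → Set₁
CTLδ AP = CTL (AP ⊎ ⊤)

δ : {AP : Set} → AP ⊎ ⊤
δ {AP} = inj₂ {A = AP} tt

data CTL∞ (AP : Set) : Set₁ where
  atom  : AP → CTL∞ AP
  neg   : CTL∞ AP → CTL∞ AP
  conj  : (I : Set) → (I → CTL∞ AP) → CTL∞ AP
  EU    : CTL∞ AP → CTL∞ AP → CTL∞ AP
  E∞G   : CTL∞ AP → CTL∞ AP

record InfPath {AP} (K : Kripke AP) (s : State K) : Set where
  field
    iseq   : ℕ → State K
    istart : iseq 0 ≡ s
    isteps : ∀ i → _⟶_ K (iseq i) (iseq (suc i))

open InfPath public

sat∞ : ∀ {AP} (K : Kripke AP) → CTL∞ AP → State K → Set
sat∞ K (atom p)   s = L K s p
sat∞ K (neg φ)    s = ¬ sat∞ K φ s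
sat∞ K (conj I f) s = ∀ (i : I) → sat∞ K (f i) s
sat∞ K (EU φ ψ)   s = Σ (MaxPath K s) λ π → PathU π (sat∞ K φ) (sat∞ K ψ)
sat∞ K (E∞G φ)    s = Σ (InfPath K s) λ π → ∀ i → sat∞ K φ (iseq π i)

-- Deadlock extension D(K): states `just s` for s ∈ S, plus s_δ = nothing

DL : ∀ {AP} (K : Kripke AP) → Maybe (State K) → AP ⊎ ⊤ → Set
DL K (just s) (inj₁ p) = L K s p
DL K (just s) (inj₂ _) = ⊥
DL K nothing  (inj₁ p) = ⊥
DL K nothing  (inj₂ _) = ⊤

data DStep {AP} (K : Kripke AP) : Maybe (State K) → Maybe (State K) → Set where
  old  : ∀ {s t} → _⟶_ K s t → DStep K (just s) (just t)
  dead : ∀ {s} → Deadlock K s → DStep K (just s) nothing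
  loop : DStep K nothing nothing

DK : ∀ {AP} → Kripke AP → Kripke (AP ⊎ ⊤)
DK K = record { State = Maybe (State K) ; L = DL K ; _⟶_ = DStep K }

-- In D(K) no state is a deadlock and s_δ only sees itself, so every maximal path of D(K) from a
-- state of K either stays in K forever, or follows a run of K into a deadlock and then loops in s_δ.
-- D: guarding negations and conjunctions by ¬δ makes every D φ false at s_δ, so the second kind of
-- path never matters and EU, EG of D(K) are EU, E∞G of K. E: the truth of a CTL_δ formula at s_δ is
-- a constant, and although deadlocks are not definable without next, "an a-run into a deadlock" is
-- (EFin a), so each of EU and EG splits into a CTL_∞ formula for each kind of path. Excluded middle
-- supplies maximal paths, successors along infinite paths, and the classical reading of EG and ∨.

module Submission where

open import Defs
open import Level using (0ℓ)
open import Axiom.ExcludedMiddle using (ExcludedMiddle)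
open import Data.Bool using (Bool; true; false; if_then_else_)
open import Data.Empty using (⊥; ⊥-elim)
open import Data.Maybe using (Maybe; just; nothing)
open import Data.Maybe.Properties using (just-injective)
open import Data.Nat using (ℕ; zero; suc; _≤_; _<_; z≤n; s≤s; s≤s⁻¹; z<s; s<s)
open import Data.Nat.Properties using (≤-trans)
open import Data.Product using (Σ; _×_; _,_; proj₁; proj₂; map₂)
open import Data.Product.Function.NonDependent.Propositional using (_×-⇔_)
open import Data.Sum as Sum using (_⊎_; inj₁; inj₂; [_,_]; fromInj₁)
open import Data.Sum.Function.Propositional using (_⊎-⇔_)
open import Data.Unit using (⊤; tt)
open import Function using (_∘_; id)
open import Function.Bundles using (_⇔_; mk⇔; Equivalence)
open import Function.Construct.Identity using (⇔-id)
open import Function.Construct.Symmetry using (⇔-sym)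
open import Function.Related.Propositional using (module EquationalReasoning; equivalence)
open import Function.Related.TypeIsomorphisms using (¬-cong-⇔)
open import Relation.Nullary using (¬_; yes; no)
open import Relation.Nullary.Decidable using (decidable-stable)
open import Relation.Binary.PropositionalEquality using (_≡_; refl; sym; trans; cong; subst; subst₂)

open Equivalence using (to; from)
open EquationalReasoning {equivalence}

∀-cong-⇔ : ∀ {I : Set} {A B : I → Set} → (∀ i → A i ⇔ B i) → (∀ i → A i) ⇔ (∀ i → B i)
∀-cong-⇔ e = mk⇔ (λ h i → to (e i) (h i)) (λ h i → from (e i) (h i))

⊎-absurdʳ : ∀ {A B : Set} → ¬ B → A ⇔ (A ⊎ B)
⊎-absurdʳ ¬b = mk⇔ inj₁ (fromInj₁ (⊥-elim ∘ ¬b))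

inRange-zero : ∀ b → InRange 0 b
inRange-zero inf     = tt
inRange-zero (fin n) = z≤n

inRange-≤ : ∀ {j k} b → j ≤ k → InRange k b → InRange j b
inRange-≤ inf     _   _   = tt
inRange-≤ (fin n) j≤k k≤n = ≤-trans j≤k k≤n

sucBound : Bound → Bound
sucBound inf     = inf
sucBound (fin n) = fin (suc n)

inRange-suc : ∀ {k} b → InRange k b → InRange (suc k) (sucBound b)
inRange-suc inf     _   = tt
inRange-suc (fin n) k≤n = s≤s k≤n

inRange-suc⁻¹ : ∀ {k} b → InRange (suc k) (sucBound b) → InRange k b
inRange-suc⁻¹ inf     _ = tt
inRange-suc⁻¹ (fin n) r = s≤s⁻¹ r

Always : ∀ {AP} {K : Kripke AP} {s} → MaxPath K s → (State K → Set) → Set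
Always π P = ∀ k → InRange k (bound π) → P (seq π k)

ForeverMax : ∀ {AP} (K : Kripke AP) → (State K → Set) → State K → Set
ForeverMax K P s = Σ (MaxPath K s) λ π → Always π P

ForeverInf : ∀ {AP} (K : Kripke AP) → (State K → Set) → State K → Set
ForeverInf K P s = Σ (InfPath K s) λ ρ → ∀ i → P (iseq ρ i)

data Until {AP} (K : Kripke AP) (P Q : State K → Set) : State K → Set where
  now   : ∀ {s} → Q s → Until K P Q s
  later : ∀ {s t} → P s → _⟶_ K s t → Until K P Q t → Until K P Q s

data UntilDeadlock {AP} (K : Kripke AP) (P : State K → Set) : State K → Set where
  stuck : ∀ {s} → P s → Deadlock K s → UntilDeadlock K P s
  later : ∀ {s t} → P s → _⟶_ K s t → UntilDeadlock K P t → UntilDeadlock K P s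

module _ {AP : Set} {K : Kripke AP} where
  private
    _↝_ : State K → State K → Set
    _↝_ = _⟶_ K

  until-map : ∀ {P P′ Q Q′ : State K → Set} {s} →
              (∀ {x} → P x → P′ x) → (∀ {x} → Q x → Q′ x) → Until K P Q s → Until K P′ Q′ s
  until-map f g (now q)        = now (g q)
  until-map f g (later p st u) = later (f p) st (until-map f g u)

  until-cong : ∀ {P P′ Q Q′ : State K → Set} {s} →
               (∀ x → P x ⇔ P′ x) → (∀ x → Q x ⇔ Q′ x) → Until K P Q s ⇔ Until K P′ Q′ s
  until-cong e e′ = mk⇔ (until-map (to (e _)) (to (e′ _))) (until-map (from (e _)) (from (e′ _)))

  untilDeadlock-map : ∀ {P P′ : State K → Set} {s} →
                      (∀ {x} → P x → P′ x) → UntilDeadlock K P s → UntilDeadlock K P′ s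
  untilDeadlock-map f (stuck p d)     = stuck (f p) d
  untilDeadlock-map f (later p st dl) = later (f p) st (untilDeadlock-map f dl)

  untilDeadlock-cong : ∀ {P P′ : State K → Set} {s} →
                       (∀ x → P x ⇔ P′ x) → UntilDeadlock K P s ⇔ UntilDeadlock K P′ s
  untilDeadlock-cong e = mk⇔ (untilDeadlock-map (to (e _))) (untilDeadlock-map (from (e _)))

  foreverInf-map : ∀ {P P′ : State K → Set} {s} → (∀ {x} → P x → P′ x) → ForeverInf K P s → ForeverInf K P′ s
  foreverInf-map f (ρ , all) = ρ , λ i → f (all i)

  foreverInf-cong : ∀ {P P′ : State K → Set} {s} → (∀ x → P x ⇔ P′ x) → ForeverInf K P s ⇔ ForeverInf K P′ s
  foreverInf-cong e = mk⇔ (foreverInf-map λ {x} → to (e x)) (foreverInf-map λ {x} → from (e x))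

  until⇒untilDeadlock : ∀ {P Q : State K → Set} {s} →
                        (∀ {u} → Q u → UntilDeadlock K P u) → Until K P Q s → UntilDeadlock K P s
  until⇒untilDeadlock f (now q)        = f q
  until⇒untilDeadlock f (later p st u) = later p st (until⇒untilDeadlock f u)

  untilDeadlock⇒until : ∀ {P Q : State K → Set} {s} →
                        (∀ {u} → P u → Deadlock K u → Q u) → UntilDeadlock K P s → Until K P Q s
  untilDeadlock⇒until f (stuck p d)     = now (f p d)
  untilDeadlock⇒until f (later p st dl) = later p st (untilDeadlock⇒until f dl)

  until⇒target : ∀ {P Q : State K → Set} {s} → Until K P Q s → Σ (State K) Q
  until⇒target (now q)       = _ , q
  until⇒target (later _ _ u) = until⇒target u

  deadlock-¬until : ∀ {P Q : State K → Set} {s} → ¬ Q s → Deadlock K s → ¬ Until K P Q s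
  deadlock-¬until ¬q d (now q)        = ¬q q
  deadlock-¬until ¬q d (later _ st _) = d _ st

  deadlock-¬infPath : ∀ {s} → Deadlock K s → ¬ InfPath K s
  deadlock-¬infPath d ρ = d (iseq ρ 1) (subst (_↝ iseq ρ 1) (istart ρ) (isteps ρ 0))

  _◅_ : ∀ {s t} → s ↝ t → MaxPath K t → MaxPath K s
  _◅_ {s} st π = record
    { seq     = seq′
    ; bound   = sucBound (bound π)
    ; start   = refl
    ; steps   = steps′
    ; maximal = maximal′ (bound π) refl
    }
    where
    seq′ : ℕ → State K
    seq′ zero    = s
    seq′ (suc i) = seq π i
    steps′ : ∀ i → InRange (suc i) (sucBound (bound π)) → seq′ i ↝ seq′ (suc i)
    steps′ zero    _ = subst (s ↝_) (sym (start π)) st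
    steps′ (suc i) r = steps π i (inRange-suc⁻¹ (bound π) r)
    maximal′ : ∀ b → bound π ≡ b → ∀ n → sucBound b ≡ fin n → Deadlock K (seq′ n)
    maximal′ inf     _ _ ()
    maximal′ (fin m) e _ refl = maximal π m e

  always-◅ : ∀ {P : State K → Set} {s t} (st : s ↝ t) {π : MaxPath K t} →
             P s → Always π P → Always (st ◅ π) P
  always-◅ st     p a zero    _ = p
  always-◅ st {π} p a (suc k) r = a k (inRange-suc⁻¹ (bound π) r)

  stuckPath : ∀ {s} → Deadlock K s → MaxPath K s
  stuckPath {s} d = record
    { seq = λ _ → s ; bound = fin 0 ; start = refl ; steps = λ _ () ; maximal = λ _ _ → d }

  infPath⇒maxPath : ∀ {s} → InfPath K s → MaxPath K s
  infPath⇒maxPath ρ = record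
    { seq = iseq ρ ; bound = inf ; start = istart ρ ; steps = λ i _ → isteps ρ i ; maximal = λ _ () }

  foreverInf⇒foreverMax : ∀ {P : State K → Set} {s} → ForeverInf K P s → ForeverMax K P s
  foreverInf⇒foreverMax (ρ , all) = infPath⇒maxPath ρ , λ k _ → all k

  untilDeadlock⇒foreverMax : ∀ {P : State K → Set} {s} → UntilDeadlock K P s → ForeverMax K P s
  untilDeadlock⇒foreverMax (stuck p d)     = stuckPath d , λ _ _ → p
  untilDeadlock⇒foreverMax {P} (later p st dl) =
    let π , a = untilDeadlock⇒foreverMax dl in st ◅ π , always-◅ {P = P} st {π} p a

  foreverMax-start : ∀ {P : State K → Set} {s} → ForeverMax K P s → P s
  foreverMax-start {P} (π , a) = subst P (start π) (a 0 (inRange-zero (bound π)))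

  until-fromSeq : ∀ {P Q : State K → Set} (f : ℕ → State K) k →
                  (∀ i → i < k → f i ↝ f (suc i)) → Q (f k) → (∀ j → j < k → P (f j)) → Until K P Q (f 0)
  until-fromSeq f zero    _  q _  = now q
  until-fromSeq f (suc k) st q ps =
    later (ps 0 z<s) (st 0 z<s)
          (until-fromSeq (f ∘ suc) k (λ i i<k → st (suc i) (s<s i<k)) q (λ j j<k → ps (suc j) (s<s j<k)))

  pathU⇒until : ∀ {P Q : State K → Set} {s} (π : MaxPath K s) → PathU π P Q → Until K P Q s
  pathU⇒until {P} {Q} π (k , r , q , ps) =
    subst (Until K P Q) (start π)
          (until-fromSeq (seq π) k (λ i i<k → steps π i (inRange-≤ (bound π) i<k r)) q ps)

  unfold : (G : State K → Set) → (∀ {v} → G v → Σ (State K) λ t → G t × v ↝ t) →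
           ∀ {s} → G s → ForeverInf K G s
  unfold G next {s} g = ρ , proj₂ ∘ walk
    where
    walk : ℕ → Σ (State K) G
    walk zero    = s , g
    walk (suc i) = let t , gt , _ = next (proj₂ (walk i)) in t , gt
    ρ : InfPath K s
    ρ = record
      { iseq = proj₁ ∘ walk ; istart = refl ; isteps = λ i → proj₂ (proj₂ (next (proj₂ (walk i)))) }

module DeadlockExtension {AP : Set} (K : Kripke AP) where

  deadlockFree : ∀ m → ¬ Deadlock (DK K) m
  deadlockFree (just s) d = d nothing (dead (λ t st → d (just t) (old st)))
  deadlockFree nothing  d = d nothing loop

  alwaysInRange : ∀ {m} (π : MaxPath (DK K) m) k → InRange k (bound π)
  alwaysInRange π k with bound π in eq
  ... | inf   = tt
  ... | fin n = ⊥-elim (deadlockFree (seq π n) (maximal π n eq))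

  sinkPath : MaxPath (DK K) nothing
  sinkPath = record
    { seq = λ _ → nothing ; bound = inf ; start = refl ; steps = λ _ _ → loop ; maximal = λ _ () }

  until-sink : ∀ {P Q} → Until (DK K) P Q nothing → Q nothing
  until-sink (now q)          = q
  until-sink (later _ loop u) = until-sink u

  foreverMax-sink : ∀ {P} → ForeverMax (DK K) P nothing ⇔ P nothing
  foreverMax-sink {P} = mk⇔ (foreverMax-start {K = DK K} {P = P}) (λ p → sinkPath , λ _ _ → p)

  IntoSink : (P Q : Maybe (State K) → Set) → State K → Set
  IntoSink P Q s = Q nothing × UntilDeadlock K (P ∘ just) s

  until-DK⇔ : ∀ {P Q : Maybe (State K) → Set} {s} →
              Until (DK K) P Q (just s) ⇔ (Until K (P ∘ just) (Q ∘ just) s ⊎ IntoSink P Q s)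
  until-DK⇔ {P} {Q} = mk⇔ split join
    where
    split : ∀ {s} → Until (DK K) P Q (just s) → Until K (P ∘ just) (Q ∘ just) s ⊎ IntoSink P Q s
    split (now q)              = inj₁ (now q)
    split (later p (old st) u) = Sum.map (later p st) (map₂ (later p st)) (split u)
    split (later p (dead d) u) = inj₂ (until-sink u , stuck p d)
    embed : ∀ {s} → Until K (P ∘ just) (Q ∘ just) s → Until (DK K) P Q (just s)
    embed (now q)        = now q
    embed (later p st u) = later p (old st) (embed u)
    viaSink : ∀ {s} → Q nothing → UntilDeadlock K (P ∘ just) s → Until (DK K) P Q (just s)
    viaSink q (stuck p d)     = later p (dead d) (now q)
    viaSink q (later p st dl) = later p (old st) (viaSink q dl)
    join : ∀ {s} → Until K (P ∘ just) (Q ∘ just) s ⊎ IntoSink P Q s → Until (DK K) P Q (just s)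
    join (inj₁ u)        = embed u
    join (inj₂ (q , dl)) = viaSink q dl

  -- A path that visits s_δ only enters it after a P-run into a deadlock of K.
  staysInK : ∀ {P : Maybe (State K) → Set} {s} → ¬ IntoSink P P s →
             (π : MaxPath (DK K) (just s)) → Always π P → ∀ i → Σ (State K) λ x → seq π i ≡ just x
  staysInK {P} {s} ¬sinkRun π a i = let x , e , _ = visit i in x , e
    where
    Back : State K → Set
    Back x = UntilDeadlock K (P ∘ just) x → UntilDeadlock K (P ∘ just) s
    advance : ∀ {x m} → DStep K (just x) m → P (just x) → P m → Back x →
              Σ (State K) λ y → m ≡ just y × Back y
    advance (old st) p _  back = _ , refl , back ∘ later p st
    advance (dead d) p p∅ back = ⊥-elim (¬sinkRun (p∅ , back (stuck p d)))
    visit : ∀ i → Σ (State K) λ x → seq π i ≡ just x × Back x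
    visit zero    = s , start π , id
    visit (suc i) =
      let x , e , back = visit i in
      advance (subst (λ m → DStep K m (seq π (suc i))) e (steps π i (alwaysInRange π (suc i))))
              (subst P e (a i (alwaysInRange π i))) (a (suc i) (alwaysInRange π (suc i))) back

  restrict : ∀ {s} (π : MaxPath (DK K) (just s)) → (∀ i → Σ (State K) λ x → seq π i ≡ just x) →
             Σ (InfPath K s) λ ρ → ∀ i → seq π i ≡ just (iseq ρ i)
  restrict π js = ρ , proj₂ ∘ js
    where
    oldStep : ∀ {x y} → DStep K (just x) (just y) → _⟶_ K x y
    oldStep (old st) = st
    ρ : InfPath _ _
    ρ = record
      { iseq   = proj₁ ∘ js
      ; istart = just-injective (trans (sym (proj₂ (js 0))) (start π))
      ; isteps = λ i → oldStep (subst₂ (DStep K) (proj₂ (js i)) (proj₂ (js (suc i)))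
                                        (steps π i (alwaysInRange π (suc i))))
      }

  liftForeverInf : ∀ {P : Maybe (State K) → Set} {s} →
                   ForeverInf K (P ∘ just) s → ForeverInf (DK K) P (just s)
  liftForeverInf (ρ , all) =
    record { iseq = just ∘ iseq ρ ; istart = cong just (istart ρ) ; isteps = old ∘ isteps ρ } , all

  intoSink⇒foreverMax : ∀ {P : Maybe (State K) → Set} {s} → IntoSink P P s → ForeverMax (DK K) P (just s)
  intoSink⇒foreverMax {P} (p∅ , stuck p d) =
    dead d ◅ sinkPath , always-◅ {K = DK K} {P = P} (dead d) p (λ _ _ → p∅)
  intoSink⇒foreverMax {P} (p∅ , later p st dl) =
    let π , a = intoSink⇒foreverMax {P} (p∅ , dl) in
    old st ◅ π , always-◅ {K = DK K} {P = P} (old st) {π} p a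

⊤∞ : ∀ {AP} → CTL∞ AP
⊤∞ = conj ⊥ λ ()

⊥∞ : ∀ {AP} → CTL∞ AP
⊥∞ = neg ⊤∞

_∧∞_ : ∀ {AP} → CTL∞ AP → CTL∞ AP → CTL∞ AP
a ∧∞ b = conj Bool λ x → if x then a else b

_∨∞_ : ∀ {AP} → CTL∞ AP → CTL∞ AP → CTL∞ AP
a ∨∞ b = neg (neg a ∧∞ neg b)

-- A state from which a cannot be left and which has no infinite a-path has an a-run into a deadlock.
EFin : ∀ {AP} → CTL∞ AP → CTL∞ AP
EFin a = EU a (a ∧∞ (neg (EU a (neg a)) ∧∞ neg (E∞G a)))

_∧¬δ : ∀ {AP} → CTLδ AP → CTLδ AP
φ ∧¬δ = conj Bool λ x → if x then φ else neg (atom δ)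

D : ∀ {AP} → CTL∞ AP → CTLδ AP
D (atom p)   = atom (inj₁ p)
D (neg φ)    = neg (D φ) ∧¬δ
D (conj I f) = conj I (D ∘ f) ∧¬δ
D (EU φ ψ)   = EU (D φ) (D ψ)
D (E∞G φ)    = EG (D φ)

sinkValue : ∀ {AP} → CTLδ AP → CTL∞ AP
sinkValue (atom (inj₁ _)) = ⊥∞
sinkValue (atom (inj₂ _)) = ⊤∞
sinkValue (neg φ)         = neg (sinkValue φ)
sinkValue (conj I f)      = conj I (sinkValue ∘ f)
sinkValue (EU φ ψ)        = sinkValue ψ
sinkValue (EG φ)          = sinkValue φ

E : ∀ {AP} → CTLδ AP → CTL∞ AP
E (atom (inj₁ p)) = atom p
E (atom (inj₂ _)) = ⊥∞
E (neg φ)         = neg (E φ)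
E (conj I f)      = conj I (E ∘ f)
E (EU φ ψ)        = EU (E φ) (E ψ) ∨∞ (sinkValue ψ ∧∞ EFin (E φ))
E (EG φ)          = E∞G (E φ) ∨∞ (sinkValue φ ∧∞ EFin (E φ))

module Classical (em : ExcludedMiddle 0ℓ) where

  module _ {AP : Set} {K : Kripke AP} where

    escape-trichotomy : ∀ {P : State K → Set} {s} → P s →
                        Until K P (¬_ ∘ P) s ⊎ ForeverInf K P s ⊎ UntilDeadlock K P s
    escape-trichotomy {P} {s} p with em {Until K P (¬_ ∘ P) s} | em {UntilDeadlock K P s}
    ... | yes escape | _       = inj₁ escape
    ... | no _       | yes run = inj₂ (inj₂ run)
    ... | no ¬escape | no ¬run =
      inj₂ (inj₁ (foreverInf-map {P = Trapped} {P′ = P} proj₁ (unfold Trapped next (p , ¬escape , ¬run))))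
      where
      Trapped : State K → Set
      Trapped v = P v × ¬ Until K P (¬_ ∘ P) v × ¬ UntilDeadlock K P v
      next : ∀ {v} → Trapped v → Σ (State K) λ t → Trapped t × _⟶_ K v t
      next {v} (pv , ¬esc , ¬dl) with em {Σ (State K) (_⟶_ K v)}
      ... | no ¬step = ⊥-elim (¬dl (stuck pv λ t st → ¬step (t , st)))
      ... | yes (t , st) with em {P t}
      ...   | no ¬pt = ⊥-elim (¬esc (later pv st (now ¬pt)))
      ...   | yes pt = t , (pt , ¬esc ∘ later pv st , ¬dl ∘ later pv st) , st

    maxPath : ∀ s → MaxPath K s
    maxPath s with escape-trichotomy {P = λ _ → ⊤} tt
    ... | inj₁ escape         = ⊥-elim (proj₂ (until⇒target escape) tt)
    ... | inj₂ (inj₁ (ρ , _)) = infPath⇒maxPath ρ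
    ... | inj₂ (inj₂ run)     = proj₁ (untilDeadlock⇒foreverMax run)

    until⇒pathU : ∀ {P Q : State K → Set} {s} → Until K P Q s → Σ (MaxPath K s) λ π → PathU π P Q
    until⇒pathU {Q = Q} {s} (now q) = π , 0 , inRange-zero (bound π) , subst Q (sym (start π)) q , λ _ ()
      where
      π : MaxPath K s
      π = maxPath s
    until⇒pathU {P} (later p st u) =
      let π , k , r , q , ps = until⇒pathU u in
      st ◅ π , suc k , inRange-suc (bound π) r , q , λ { zero _ → p ; (suc j) (s<s j<k) → ps j j<k }

    ∃pathU⇔until : ∀ {P Q : State K → Set} {s} → (Σ (MaxPath K s) λ π → PathU π P Q) ⇔ Until K P Q s
    ∃pathU⇔until = mk⇔ (λ (π , u) → pathU⇒until π u) until⇒pathU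

    pathG⇔always : ∀ {P : State K → Set} {s} (π : MaxPath K s) → PathG π P ⇔ Always π P
    pathG⇔always π = mk⇔ (λ g k r → decidable-stable em λ ¬p → g (k , r , ¬p , λ _ _ → tt))
                         (λ a (k , r , ¬p , _) → ¬p (a k r))

    ∃pathG⇔foreverMax : ∀ {P : State K → Set} {s} → (Σ (MaxPath K s) λ π → PathG π P) ⇔ ForeverMax K P s
    ∃pathG⇔foreverMax {P} = mk⇔ (λ (π , g) → π , to (pathG⇔always {P} π) g)
                                (λ (π , a) → π , from (pathG⇔always {P} π) a)

    sat-EU : ∀ φ ψ {s} → sat K (EU φ ψ) s ⇔ Until K (sat K φ) (sat K ψ) s
    sat-EU φ ψ = ∃pathU⇔until

    sat∞-EU : ∀ φ ψ {s} → sat∞ K (EU φ ψ) s ⇔ Until K (sat∞ K φ) (sat∞ K ψ) s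
    sat∞-EU φ ψ = ∃pathU⇔until

    sat-EG : ∀ φ {s} → sat K (EG φ) s ⇔ ForeverMax K (sat K φ) s
    sat-EG φ = ∃pathG⇔foreverMax {P = sat K φ}

  module _ {AP : Set} (K : Kripke AP) where
    open DeadlockExtension K

    foreverMax-DK⇔ : ∀ {P : Maybe (State K) → Set} {s} →
                     ForeverMax (DK K) P (just s) ⇔ (ForeverInf K (P ∘ just) s ⊎ IntoSink P P s)
    foreverMax-DK⇔ {P} {s} = mk⇔ split join
      where
      split : ForeverMax (DK K) P (just s) → ForeverInf K (P ∘ just) s ⊎ IntoSink P P s
      split (π , a) with em {IntoSink P P s}
      ... | yes sinkRun = inj₂ sinkRun
      ... | no ¬sinkRun =
        let ρ , onρ = restrict π (staysInK {P} ¬sinkRun π a) in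
        inj₁ (ρ , λ i → subst P (onρ i) (a i (alwaysInRange π i)))
      join : ForeverInf K (P ∘ just) s ⊎ IntoSink P P s → ForeverMax (DK K) P (just s)
      join (inj₁ forever) = foreverInf⇒foreverMax {P = P} (liftForeverInf {P} forever)
      join (inj₂ run)     = intoSink⇒foreverMax {P} run

  module Correctness {AP : Set} (K : Kripke AP) where
    open DeadlockExtension K

    sat∞-⊥ : ∀ {s} → ¬ sat∞ K ⊥∞ s
    sat∞-⊥ h = h λ ()

    sat∞-∧ : ∀ a b {s} → sat∞ K (a ∧∞ b) s ⇔ (sat∞ K a s × sat∞ K b s)
    sat∞-∧ a b = mk⇔ (λ h → h true , h false) (λ (x , y) → λ { true → x ; false → y })

    sat∞-∨ : ∀ a b {s} → sat∞ K (a ∨∞ b) s ⇔ (sat∞ K a s ⊎ sat∞ K b s)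
    sat∞-∨ a b = mk⇔ (λ h → decidable-stable em λ ¬ab → h λ { true → ¬ab ∘ inj₁ ; false → ¬ab ∘ inj₂ })
                     (λ ab h → [ h true , h false ] ab)

    sat∞-∨∧ : ∀ a b c {s} → sat∞ K (a ∨∞ (b ∧∞ c)) s ⇔ (sat∞ K a s ⊎ (sat∞ K b s × sat∞ K c s))
    sat∞-∨∧ a b c = begin
      sat∞ K (a ∨∞ (b ∧∞ c)) _                ∼⟨ sat∞-∨ a (b ∧∞ c) ⟩
      (sat∞ K a _ ⊎ sat∞ K (b ∧∞ c) _)        ∼⟨ ⇔-id _ ⊎-⇔ sat∞-∧ b c ⟩
      (sat∞ K a _ ⊎ (sat∞ K b _ × sat∞ K c _)) ∎

    sat∞-EFin : ∀ a {s} → sat∞ K (EFin a) s ⇔ UntilDeadlock K (sat∞ K a) s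
    sat∞-EFin a = mk⇔ (until⇒untilDeadlock trapped ∘ to (sat∞-EU a Target))
                      (from (sat∞-EU a Target) ∘ untilDeadlock⇒until endpoint)
      where
      Target : CTL∞ AP
      Target = a ∧∞ (neg (EU a (neg a)) ∧∞ neg (E∞G a))
      trapped : ∀ {u} → sat∞ K Target u → UntilDeadlock K (sat∞ K a) u
      trapped h with escape-trichotomy (h true)
      ... | inj₁ escape         = ⊥-elim (h false true (from (sat∞-EU a (neg a)) escape))
      ... | inj₂ (inj₁ forever) = ⊥-elim (h false false forever)
      ... | inj₂ (inj₂ run)     = run
      endpoint : ∀ {u} → sat∞ K a u → Deadlock K u → sat∞ K Target u
      endpoint p d = λ { true → p
                       ; false → λ { true → deadlock-¬until (λ ¬p → ¬p p) d ∘ to (sat∞-EU a (neg a))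
                                   ; false → deadlock-¬infPath d ∘ proj₁ } }

    sat-∧¬δ : ∀ φ {s} → sat (DK K) (φ ∧¬δ) (just s) ⇔ sat (DK K) φ (just s)
    sat-∧¬δ φ = mk⇔ (λ h → h true) (λ h → λ { true → h ; false → λ () })

    ∧¬δ-sink : ∀ φ → ¬ sat (DK K) (φ ∧¬δ) nothing
    ∧¬δ-sink φ h = h false tt

    D-sink : ∀ φ → ¬ sat (DK K) (D φ) nothing
    D-sink (atom p) ()
    D-sink (neg φ)    = ∧¬δ-sink (neg (D φ))
    D-sink (conj I f) = ∧¬δ-sink (conj I (D ∘ f))
    D-sink (EU φ ψ) h = D-sink ψ (until-sink (to (sat-EU (D φ) (D ψ)) h))
    D-sink (E∞G φ) h  = D-sink φ (foreverMax-start {P = sat (DK K) (D φ)} (to (sat-EG (D φ)) h))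

    D-correct : ∀ φ s → sat∞ K φ s ⇔ sat (DK K) (D φ) (just s)
    D-correct (atom p) s = mk⇔ id id
    D-correct (neg φ) s = begin
      (¬ sat∞ K φ s)                ∼⟨ ¬-cong-⇔ (D-correct φ s) ⟩
      (¬ sat (DK K) (D φ) (just s)) ∼⟨ ⇔-sym (sat-∧¬δ (neg (D φ))) ⟩
      sat (DK K) (D (neg φ)) (just s) ∎
    D-correct (conj I f) s = begin
      (∀ i → sat∞ K (f i) s)                ∼⟨ ∀-cong-⇔ (λ i → D-correct (f i) s) ⟩
      (∀ i → sat (DK K) (D (f i)) (just s)) ∼⟨ ⇔-sym (sat-∧¬δ (conj I (D ∘ f))) ⟩
      sat (DK K) (D (conj I f)) (just s)    ∎
    D-correct (EU φ ψ) s = begin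
      sat∞ K (EU φ ψ) s
        ∼⟨ sat∞-EU φ ψ ⟩
      Until K (sat∞ K φ) (sat∞ K ψ) s
        ∼⟨ until-cong (D-correct φ) (D-correct ψ) ⟩
      Until K (Dφ ∘ just) (Dψ ∘ just) s
        ∼⟨ ⊎-absurdʳ (D-sink ψ ∘ proj₁) ⟩
      (Until K (Dφ ∘ just) (Dψ ∘ just) s ⊎ IntoSink Dφ Dψ s)
        ∼⟨ ⇔-sym (until-DK⇔ {Dφ}) ⟩
      Until (DK K) Dφ Dψ (just s)
        ∼⟨ ⇔-sym (sat-EU (D φ) (D ψ)) ⟩
      sat (DK K) (D (EU φ ψ)) (just s) ∎
      where
      Dφ Dψ : Maybe (State K) → Set
      Dφ = sat (DK K) (D φ)
      Dψ = sat (DK K) (D ψ)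
    D-correct (E∞G φ) s = begin
      ForeverInf K (sat∞ K φ) s
        ∼⟨ foreverInf-cong (D-correct φ) ⟩
      ForeverInf K (Dφ ∘ just) s
        ∼⟨ ⊎-absurdʳ (D-sink φ ∘ proj₁) ⟩
      (ForeverInf K (Dφ ∘ just) s ⊎ IntoSink Dφ Dφ s)
        ∼⟨ ⇔-sym (foreverMax-DK⇔ K {Dφ}) ⟩
      ForeverMax (DK K) Dφ (just s)
        ∼⟨ ⇔-sym (sat-EG (D φ)) ⟩
      sat (DK K) (D (E∞G φ)) (just s) ∎
      where
      Dφ : Maybe (State K) → Set
      Dφ = sat (DK K) (D φ)

    sinkValue-correct : ∀ φ {s} → sat (DK K) φ nothing ⇔ sat∞ K (sinkValue φ) s
    sinkValue-correct (atom (inj₁ _)) = mk⇔ (λ ()) sat∞-⊥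
    sinkValue-correct (atom (inj₂ _)) = mk⇔ (λ _ ()) (λ _ → tt)
    sinkValue-correct (neg φ)         = ¬-cong-⇔ (sinkValue-correct φ)
    sinkValue-correct (conj I f)      = ∀-cong-⇔ (λ i → sinkValue-correct (f i))
    sinkValue-correct (EU φ ψ) {s} = begin
      sat (DK K) (EU φ ψ) nothing                         ∼⟨ sat-EU φ ψ ⟩
      Until (DK K) (sat (DK K) φ) (sat (DK K) ψ) nothing  ∼⟨ mk⇔ until-sink now ⟩
      sat (DK K) ψ nothing                                ∼⟨ sinkValue-correct ψ ⟩
      sat∞ K (sinkValue ψ) s                              ∎
    sinkValue-correct (EG φ) {s} = begin
      sat (DK K) (EG φ) nothing             ∼⟨ sat-EG φ ⟩
      ForeverMax (DK K) (sat (DK K) φ) nothing ∼⟨ foreverMax-sink {sat (DK K) φ} ⟩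
      sat (DK K) φ nothing                  ∼⟨ sinkValue-correct φ ⟩
      sat∞ K (sinkValue φ) s                ∎

    E-correct : ∀ φ s → sat (DK K) φ (just s) ⇔ sat∞ K (E φ) s
    E-correct (atom (inj₁ p)) s = mk⇔ id id
    E-correct (atom (inj₂ _)) s = mk⇔ (λ ()) sat∞-⊥
    E-correct (neg φ) s         = ¬-cong-⇔ (E-correct φ s)
    E-correct (conj I f) s      = ∀-cong-⇔ (λ i → E-correct (f i) s)
    E-correct (EU φ ψ) s = begin
      sat (DK K) (EU φ ψ) (just s)
        ∼⟨ sat-EU φ ψ ⟩
      Until (DK K) Pφ Pψ (just s)
        ∼⟨ until-DK⇔ {Pφ} ⟩
      (Until K (Pφ ∘ just) (Pψ ∘ just) s ⊎ IntoSink Pφ Pψ s)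
        ∼⟨ until-cong (E-correct φ) (E-correct ψ) ⊎-⇔ sinkValue-correct ψ ×-⇔ untilDeadlock-cong (E-correct φ) ⟩
      (Until K Eφ Eψ s ⊎ (sat∞ K (sinkValue ψ) s × UntilDeadlock K Eφ s))
        ∼⟨ ⇔-sym (sat∞-EU (E φ) (E ψ)) ⊎-⇔ ⇔-id _ ×-⇔ ⇔-sym (sat∞-EFin (E φ)) ⟩
      (sat∞ K (EU (E φ) (E ψ)) s ⊎ (sat∞ K (sinkValue ψ) s × sat∞ K (EFin (E φ)) s))
        ∼⟨ ⇔-sym (sat∞-∨∧ _ _ _) ⟩
      sat∞ K (E (EU φ ψ)) s ∎
      where
      Pφ Pψ : Maybe (State K) → Set
      Pφ = sat (DK K) φ
      Pψ = sat (DK K) ψ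
      Eφ Eψ : State K → Set
      Eφ = sat∞ K (E φ)
      Eψ = sat∞ K (E ψ)
    E-correct (EG φ) s = begin
      sat (DK K) (EG φ) (just s)
        ∼⟨ sat-EG φ ⟩
      ForeverMax (DK K) Pφ (just s)
        ∼⟨ foreverMax-DK⇔ K {Pφ} ⟩
      (ForeverInf K (Pφ ∘ just) s ⊎ IntoSink Pφ Pφ s)
        ∼⟨ foreverInf-cong (E-correct φ) ⊎-⇔ sinkValue-correct φ ×-⇔ untilDeadlock-cong (E-correct φ) ⟩
      (ForeverInf K Eφ s ⊎ (sat∞ K (sinkValue φ) s × UntilDeadlock K Eφ s))
        ∼⟨ ⇔-id _ ⊎-⇔ ⇔-id _ ×-⇔ ⇔-sym (sat∞-EFin (E φ)) ⟩
      (sat∞ K (E∞G (E φ)) s ⊎ (sat∞ K (sinkValue φ) s × sat∞ K (EFin (E φ)) s))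
        ∼⟨ ⇔-sym (sat∞-∨∧ _ _ _) ⟩
      sat∞ K (E (EG φ)) s ∎
      where
      Pφ : Maybe (State K) → Set
      Pφ = sat (DK K) φ
      Eφ : State K → Set
      Eφ = sat∞ K (E φ)

theorem8p6 : ExcludedMiddle 0ℓ → (AP : Set) →
    Σ (CTL∞ AP → CTLδ AP) λ 𝔇 → Σ (CTLδ AP → CTL∞ AP) λ 𝔈 →
    (K : Kripke AP) (s : State K) →
    ((φ : CTL∞ AP) → (sat∞ K φ s ⇔ sat (DK K) (𝔇 φ) (just s)))
    × ((φ : CTLδ AP) → (sat (DK K) φ (just s) ⇔ sat∞ K (𝔈 φ) s))
theorem8p6 em AP = D , E , λ K s → (λ φ → D-correct K φ s) , (λ φ → E-correct K φ s)
  where open Classical.Correctness em
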